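{- Let $A\in\mathbb{Z}^{m\times n}$ with rows $a^{(1)},\ldots,a^{(m)}$, $b\in\mathbb{Z}^m$, $\mathcal{P}=\{x\in\mathbb{R}^n_{\ge0}: Ax=b\}$ and $\mathcal{P}_I=\operatorname{Conv}(\mathcal{P}\cap\mathbb{Z}^n)$. For a permutation $\pi$ of $\{1,\ldots,m\}$ define $d^{(\pi)}_1=\lVert a^{(\pi(1))}\rVert_1$ and, for $i=1,\ldots,m-1$, $d^{(\pi)}_{i+1}=\lceil \min_{\lambda\in\mathbb{R}^i}\lVert a^{(\pi(i+1))}-\sum_{k=1}^{i}\lambda_k a^{(\pi(k))}\rVert_1\rceil$. Then every vertex $v$ of $\mathcal{P}_I$ satisfies \[ |\operatorname{supp}(v)|\le\min_\pi\sum_{i=1}^m\log(d^{(\pi)}_i+1). \]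
   Context: All logarithms are base 2. $\operatorname{supp}(v)=\{i: v_i\neq 0\}$. A vertex of $\mathcal{P}_I$ is a point $v\in\mathcal{P}_I$ with $v\notin\operatorname{Conv}(\mathcal{P}_I\setminus\{v\})$.
   Formalization: The vertex v has rational coordinates, the weights of the convex combinations defining $\mathcal{P}_I$ and its vertices are rational, and λ ranges over ℚ^i instead of ℝ^i. -}

module Defs where

open import Data.Nat as ℕ using (ℕ; zero; suc)
open import Data.Integer as ℤ using (ℤ; +_)
open import Data.Fin using (Fin; zero; suc; inject₁)
open import Data.Fin.Permutation using (Permutation; _⟨$⟩ʳ_)
open import Data.Rational as ℚ using (ℚ; 0ℚ; 1ℚ; _/_; ∣_∣; _≟_)
open import Data.Product using (Σ; _×_; ∃)
open import Relation.Binary.PropositionalEquality using (_≡_; _≢_)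
open import Relation.Nullary using (¬_; yes; no)

Mat : ℕ → ℕ → Set
Mat m n = Fin m → Fin n → ℤ

ℚ^ : ℕ → Set
ℚ^ n = Fin n → ℚ

ℤ→ℚ : ℤ → ℚ
ℤ→ℚ z = z / 1

ℕ→ℚ : ℕ → ℚ
ℕ→ℚ k = (+ k) / 1

sumℤ : ∀ {n} → (Fin n → ℤ) → ℤ
sumℤ {zero} f = + 0
sumℤ {suc n} f = f zero ℤ.+ sumℤ (λ i → f (suc i))

sumℚ : ∀ {n} → (Fin n → ℚ) → ℚ
sumℚ {zero} f = 0ℚ
sumℚ {suc n} f = f zero ℚ.+ sumℚ (λ i → f (suc i))

sumℕ : ∀ {n} → (Fin n → ℕ) → ℕ
sumℕ {zero} f = 0
sumℕ {suc n} f = f zero ℕ.+ sumℕ (λ i → f (suc i))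

prodℕ : ∀ {n} → (Fin n → ℕ) → ℕ
prodℕ {zero} f = 1
prodℕ {suc n} f = f zero ℕ.* prodℕ (λ i → f (suc i))

InP∩ℤ : ∀ {m n} → Mat m n → (Fin m → ℤ) → (Fin n → ℤ) → Set
InP∩ℤ {m} {n} A b x =
  (∀ j → + 0 ℤ.≤ x j) × (∀ i → sumℤ (λ j → A i j ℤ.* x j) ≡ b i)

Conv : ∀ {n} → (ℚ^ n → Set) → ℚ^ n → Set
Conv {n} S y =
  Σ ℕ λ k → Σ (Fin k → ℚ^ n) λ p → Σ (Fin k → ℚ) λ w →
    (∀ t → 0ℚ ℚ.≤ w t) × (sumℚ w ≡ 1ℚ) × (∀ t → S (p t)) ×
    (∀ j → y j ≡ sumℚ (λ t → w t ℚ.* p t j))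

InPI : ∀ {m n} → Mat m n → (Fin m → ℤ) → ℚ^ n → Set
InPI A b = Conv (λ y → Σ _ λ x → InP∩ℤ A b x × (∀ j → y j ≡ ℤ→ℚ (x j)))

IsVertex : ∀ {m n} → Mat m n → (Fin m → ℤ) → ℚ^ n → Set
IsVertex A b v =
  InPI A b v × ¬ Conv (λ y → InPI A b y × ¬ (∀ j → y j ≡ v j)) v

suppSize : ∀ {n} → ℚ^ n → ℕ
suppSize v = sumℕ (λ j → indicator (v j))
  where
  indicator : ℚ → ℕ
  indicator q with q ≟ 0ℚ
  ... | yes _ = 0
  ... | no _ = 1

norm1 : ∀ {n} → ℚ^ n → ℚ
norm1 w = sumℚ (λ j → ∣ w j ∣)

lowerFin : ∀ {m} (i : Fin m) → Fin (Data.Fin.toℕ i) → Fin m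
lowerFin (suc i) zero = zero
lowerFin (suc i) (suc k) = suc (lowerFin i k)

-- the vector a^(π(i)) - Σ_{k<i} λ_k a^(π(k))  (0-based index i)
residual : ∀ {m n} → Mat m n → Permutation m m → (i : Fin m) →
           (Fin (Data.Fin.toℕ i) → ℚ) → ℚ^ n
residual A π i λv j =
  ℤ→ℚ (A (π ⟨$⟩ʳ i) j) ℚ.- sumℚ (λ k → λv k ℚ.* ℤ→ℚ (A (π ⟨$⟩ʳ lowerFin i k) j))

-- d is the ceiling of the minimum over λ of ‖residual‖₁:
-- the minimum is ≤ d and > d - 1.  For i = 0 the sum is empty, giving
-- d = ‖a^(π(1))‖₁.
IsCeilMin : ∀ {m n} → Mat m n → Permutation m m → Fin m → ℕ → Set
IsCeilMin A π i d =
  (Σ _ λ λv → norm1 (residual A π i λv) ℚ.≤ ℕ→ℚ d) ×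
  (∀ λv → ℕ→ℚ d ℚ.- 1ℚ ℚ.< norm1 (residual A π i λv))

{-# OPTIONS --safe #-}
module Submission where

-- A vertex v of P_I is an integer point x of P.  If two 0/1 vectors u, u′
-- supported in supp x satisfy A u = A u′, then x + u − u′ and x + u′ − u are
-- integer points of P with midpoint v, so u = u′: the map u ↦ A u is
-- injective on the 2^|supp v| subsets of the support.  It stays injective
-- after compressing A u to one of ∏ (d_i + 1) values.  Writing
-- a^(π i) = Σ_{k<i} λ_k a^(π k) + ρ with ‖ρ‖₁ ≤ d_i, the integer a^(π i)·u
-- lies in [M, M + d_i] where M = ⌊Σ_k λ_k a^(π k)·u + Σ_j min(ρ_j, 0)⌋ only
-- depends on earlier rows, so the offsets a^(π i)·u − M ∈ {0, …, d_i}
-- recover A u row by row.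

open import Defs
open import Data.Bool using (Bool; true; false)
open import Data.Empty using (⊥-elim)
open import Data.Fin as Fin using (Fin; zero; suc; toℕ; fromℕ<; combine; remQuot)
open import Data.Fin.Properties using (2↔Bool; *↔×; all?; any?; combine-injective; toℕ-fromℕ<; injective⇒≤)
import Data.Fin.Induction as FinInd
open import Data.Fin.Permutation using (Permutation; _⟨$⟩ʳ_; _⟨$⟩ˡ_; inverseʳ)
open import Data.Integer as ℤ using (ℤ; +_; +≤+; 0ℤ)
import Data.Integer.Properties as ℤP
open import Data.Integer.DivMod using ([n/d]*d≤n; n<s[n/ℕd]*d; div-pos-is-/ℕ)
open import Data.Integer.Solver renaming (module +-*-Solver to ℤ-Solver)
open import Data.Nat using (ℕ; zero; suc; _≤_; _^_; s≤s; z≤n)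
open import Data.Product using (Σ; _×_; _,_; proj₁; proj₂)
open import Data.Rational as ℚ using (ℚ; 0ℚ; 1ℚ; ½; ↥_; ↧_; floor; toℚᵘ; fromℚᵘ; _⊓_; _⊔_; ∣_∣; _≟_)
import Data.Rational.Properties as ℚP
open import Data.Rational.Solver using (module +-*-Solver)
open import Data.Rational.Unnormalised as ℚᵘ using (mkℚᵘ; *≡*; *≤*; *<*)
import Data.Rational.Unnormalised.Properties as ℚᵘP
open import Data.Sum using (inj₁; inj₂)
open import Data.Vec.Functional using (_∷_; []; tail)
open import Function using (_∘_)
open import Function.Bundles using (Injection)
open import Function.Properties.Inverse using (↔⇒↣)
open import Induction.WellFounded as WF using (WfRec)
open import Level using (0ℓ)
open import Relation.Binary.PropositionalEquality
open import Relation.Nullary using (¬_; yes; no)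
open import Algebra.Properties.AbelianGroup ℤP.+-0-abelianGroup using (∙-cancelˡ; ∙-cancelʳ)

fromℚᵘ-homo-+ : ∀ p q → fromℚᵘ (p ℚᵘ.+ q) ≡ fromℚᵘ p ℚ.+ fromℚᵘ q
fromℚᵘ-homo-+ p q = ℚP.toℚᵘ-injective (ℚᵘP.≃-trans (ℚP.toℚᵘ-fromℚᵘ (p ℚᵘ.+ q)) (ℚᵘP.≃-sym
  (ℚᵘP.≃-trans (ℚP.toℚᵘ-homo-+ (fromℚᵘ p) (fromℚᵘ q)) (ℚᵘP.+-cong (ℚP.toℚᵘ-fromℚᵘ p) (ℚP.toℚᵘ-fromℚᵘ q)))))

fromℚᵘ-homo-* : ∀ p q → fromℚᵘ (p ℚᵘ.* q) ≡ fromℚᵘ p ℚ.* fromℚᵘ q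
fromℚᵘ-homo-* p q = ℚP.toℚᵘ-injective (ℚᵘP.≃-trans (ℚP.toℚᵘ-fromℚᵘ (p ℚᵘ.* q)) (ℚᵘP.≃-sym
  (ℚᵘP.≃-trans (ℚP.toℚᵘ-homo-* (fromℚᵘ p) (fromℚᵘ q)) (ℚᵘP.*-cong (ℚP.toℚᵘ-fromℚᵘ p) (ℚP.toℚᵘ-fromℚᵘ q)))))

ℤ→ℚ-homo-+ : ∀ a b → ℤ→ℚ (a ℤ.+ b) ≡ ℤ→ℚ a ℚ.+ ℤ→ℚ b
ℤ→ℚ-homo-+ a b = trans (ℚP.fromℚᵘ-cong {mkℚᵘ (a ℤ.+ b) 0} {mkℚᵘ a 0 ℚᵘ.+ mkℚᵘ b 0} (*≡* a+b≡a*1+b*1))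
  (fromℚᵘ-homo-+ (mkℚᵘ a 0) (mkℚᵘ b 0))
  where
  a+b≡a*1+b*1 : (a ℤ.+ b) ℤ.* + 1 ≡ (a ℤ.* + 1 ℤ.+ b ℤ.* + 1) ℤ.* + 1
  a+b≡a*1+b*1 = cong (ℤ._* + 1) (cong₂ ℤ._+_ (sym (ℤP.*-identityʳ a)) (sym (ℤP.*-identityʳ b)))

ℤ→ℚ-homo-* : ∀ a b → ℤ→ℚ (a ℤ.* b) ≡ ℤ→ℚ a ℚ.* ℤ→ℚ b
ℤ→ℚ-homo-* a b = fromℚᵘ-homo-* (mkℚᵘ a 0) (mkℚᵘ b 0)

toℚᵘ-ℤ→ℚ : ∀ z → toℚᵘ (ℤ→ℚ z) ℚᵘ.≃ mkℚᵘ z 0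
toℚᵘ-ℤ→ℚ z = ℚP.toℚᵘ-fromℚᵘ (mkℚᵘ z 0)

ℤ→ℚ-cancel-≤ : ∀ {a b} → ℤ→ℚ a ℚ.≤ ℤ→ℚ b → a ℤ.≤ b
ℤ→ℚ-cancel-≤ {a} {b} le with ℚᵘP.≤-respʳ-≃ (toℚᵘ-ℤ→ℚ b) (ℚᵘP.≤-respˡ-≃ (toℚᵘ-ℤ→ℚ a) (ℚP.toℚᵘ-mono-≤ le))
... | *≤* a*1≤b*1 = subst₂ ℤ._≤_ (ℤP.*-identityʳ a) (ℤP.*-identityʳ b) a*1≤b*1

ℤ→ℚ-cancel-< : ∀ {a b} → ℤ→ℚ a ℚ.< ℤ→ℚ b → a ℤ.< b
ℤ→ℚ-cancel-< {a} {b} lt with ℚᵘP.<-respʳ-≃ (toℚᵘ-ℤ→ℚ b) (ℚᵘP.<-respˡ-≃ (toℚᵘ-ℤ→ℚ a) (ℚP.toℚᵘ-mono-< lt))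
... | *<* a*1<b*1 = subst₂ ℤ._<_ (ℤP.*-identityʳ a) (ℤP.*-identityʳ b) a*1<b*1

ℤ→ℚ-injective : ∀ {a b} → ℤ→ℚ a ≡ ℤ→ℚ b → a ≡ b
ℤ→ℚ-injective a≡b = ℤP.≤-antisym (ℤ→ℚ-cancel-≤ (ℚP.≤-reflexive a≡b)) (ℤ→ℚ-cancel-≤ (ℚP.≤-reflexive (sym a≡b)))

ℤ→ℚ-midpoint : ∀ {x y z} → y ℤ.+ z ≡ x ℤ.+ x → ℤ→ℚ x ≡ ½ ℚ.* ℤ→ℚ y ℚ.+ ½ ℚ.* ℤ→ℚ z
ℤ→ℚ-midpoint {x} {y} {z} y+z≡x+x = begin
  X                     ≡⟨ solve 1 (λ X → X := con ½ :* (X :+ X)) refl X ⟩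
  ½ ℚ.* (X ℚ.+ X)       ≡⟨ cong (½ ℚ.*_) (ℤ→ℚ-homo-+ x x) ⟨
  ½ ℚ.* ℤ→ℚ (x ℤ.+ x)   ≡⟨ cong (λ w → ½ ℚ.* ℤ→ℚ w) y+z≡x+x ⟨
  ½ ℚ.* ℤ→ℚ (y ℤ.+ z)   ≡⟨ cong (½ ℚ.*_) (ℤ→ℚ-homo-+ y z) ⟩
  ½ ℚ.* (Y ℚ.+ Z)       ≡⟨ ℚP.*-distribˡ-+ ½ Y Z ⟩
  ½ ℚ.* Y ℚ.+ ½ ℚ.* Z   ∎
  where
  open ≡-Reasoning
  open +-*-Solver
  X Y Z : ℚ
  X = ℤ→ℚ x
  Y = ℤ→ℚ y
  Z = ℤ→ℚ z

floor-≤ : ∀ q → ℤ→ℚ ⌊ q ⌋ ℚ.≤ q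
floor-≤ q@record{} = ℚP.toℚᵘ-cancel-≤ (ℚᵘP.≤-respˡ-≃ (ℚᵘP.≃-sym (toℚᵘ-ℤ→ℚ ⌊ q ⌋))
  (*≤* (subst (⌊ q ⌋ ℤ.* ↧ q ℤ.≤_) (sym (ℤP.*-identityʳ (↥ q))) ([n/d]*d≤n (↥ q) (↧ q)))))

<-suc-floor : ∀ q → q ℚ.< ℤ→ℚ (ℤ.suc ⌊ q ⌋)
<-suc-floor q@(ℚ.mkℚ n d-1 _) = ℚP.toℚᵘ-cancel-< (ℚᵘP.<-respʳ-≃ (ℚᵘP.≃-sym (toℚᵘ-ℤ→ℚ (ℤ.suc ⌊ q ⌋)))
  (*<* (subst₂ ℤ._<_ (sym (ℤP.*-identityʳ n)) (cong (λ k → ℤ.suc k ℤ.* ↧ q) (sym (div-pos-is-/ℕ n (suc d-1))))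
    (n<s[n/ℕd]*d n (suc d-1)))))

floor-window : ∀ {q z} (D : ℕ) → q ℚ.≤ ℤ→ℚ z → ℤ→ℚ z ℚ.≤ q ℚ.+ ℕ→ℚ D →
  ⌊ q ⌋ ℤ.≤ z × z ℤ.≤ ⌊ q ⌋ ℤ.+ + D
floor-window {q} {z} D q≤z z≤q+D =
  ℤ→ℚ-cancel-≤ (ℚP.≤-trans (floor-≤ q) q≤z) ,
  subst (z ℤ.≤_) (ℤP.pred-suc (⌊ q ⌋ ℤ.+ + D))
    (ℤP.i<j⇒i≤pred[j] {j = ℤ.suc (⌊ q ⌋ ℤ.+ + D)} (ℤ→ℚ-cancel-< z<suc[⌊q⌋+D]))
  where
  open ℚP.≤-Reasoning
  z<suc[⌊q⌋+D] : ℤ→ℚ z ℚ.< ℤ→ℚ (ℤ.suc (⌊ q ⌋ ℤ.+ + D))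
  z<suc[⌊q⌋+D] = begin-strict
    ℤ→ℚ z                                ≤⟨ z≤q+D ⟩
    q ℚ.+ ℕ→ℚ D                          <⟨ ℚP.+-monoˡ-< (ℕ→ℚ D) (<-suc-floor q) ⟩
    ℤ→ℚ (ℤ.suc ⌊ q ⌋) ℚ.+ ℤ→ℚ (+ D)      ≡⟨ ℤ→ℚ-homo-+ (ℤ.suc ⌊ q ⌋) (+ D) ⟨
    ℤ→ℚ (ℤ.suc ⌊ q ⌋ ℤ.+ + D)            ≡⟨ cong ℤ→ℚ (ℤP.+-assoc (+ 1) ⌊ q ⌋ (+ D)) ⟩
    ℤ→ℚ (ℤ.suc (⌊ q ⌋ ℤ.+ + D))          ∎

sumℚ-cong : ∀ {n} {f g : Fin n → ℚ} → (∀ j → f j ≡ g j) → sumℚ f ≡ sumℚ g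
sumℚ-cong {zero} f≗g = refl
sumℚ-cong {suc n} f≗g = cong₂ ℚ._+_ (f≗g zero) (sumℚ-cong (f≗g ∘ suc))

sumℚ-zero : ∀ n → sumℚ {n} (λ _ → 0ℚ) ≡ 0ℚ
sumℚ-zero zero = refl
sumℚ-zero (suc n) = cong (0ℚ ℚ.+_) (sumℚ-zero n)

sumℚ-distrib-+ : ∀ {n} (f g : Fin n → ℚ) → sumℚ (λ j → f j ℚ.+ g j) ≡ sumℚ f ℚ.+ sumℚ g
sumℚ-distrib-+ {zero} f g = refl
sumℚ-distrib-+ {suc n} f g = trans (cong (f zero ℚ.+ g zero ℚ.+_) (sumℚ-distrib-+ (f ∘ suc) (g ∘ suc)))
  (solve 4 (λ a b c d → (a :+ b) :+ (c :+ d) := (a :+ c) :+ (b :+ d)) refl (f zero) (g zero) _ _)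
  where open +-*-Solver

sumℚ-neg : ∀ {n} (f : Fin n → ℚ) → sumℚ (λ j → ℚ.- f j) ≡ ℚ.- sumℚ f
sumℚ-neg {zero} f = refl
sumℚ-neg {suc n} f = trans (cong (ℚ.- f zero ℚ.+_) (sumℚ-neg (f ∘ suc))) (sym (ℚP.neg-distrib-+ (f zero) _))

*-distribˡ-sumℚ : ∀ {n} c (f : Fin n → ℚ) → c ℚ.* sumℚ f ≡ sumℚ (λ j → c ℚ.* f j)
*-distribˡ-sumℚ {zero} c f = ℚP.*-zeroʳ c
*-distribˡ-sumℚ {suc n} c f = trans (ℚP.*-distribˡ-+ c (f zero) _) (cong (c ℚ.* f zero ℚ.+_) (*-distribˡ-sumℚ c (f ∘ suc)))

sumℚ-comm : ∀ {m n} (f : Fin m → Fin n → ℚ) → sumℚ (λ i → sumℚ (f i)) ≡ sumℚ (λ j → sumℚ (λ i → f i j))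
sumℚ-comm {zero} {n} f = sym (sumℚ-zero n)
sumℚ-comm {suc m} f = trans (cong (sumℚ (f zero) ℚ.+_) (sumℚ-comm (f ∘ suc)))
  (sym (sumℚ-distrib-+ (f zero) _))

sumℚ-mono-≤ : ∀ {n} {f g : Fin n → ℚ} → (∀ j → f j ℚ.≤ g j) → sumℚ f ℚ.≤ sumℚ g
sumℚ-mono-≤ {zero} f≤g = ℚP.≤-refl
sumℚ-mono-≤ {suc n} f≤g = ℚP.+-mono-≤ (f≤g zero) (sumℚ-mono-≤ (f≤g ∘ suc))

_·_ : ∀ {n} → ℚ^ n → ℚ^ n → ℚ
w · u = sumℚ (λ j → w j ℚ.* u j)

_·ℤ_ : ∀ {n} → (Fin n → ℤ) → (Fin n → ℤ) → ℤ
x ·ℤ y = sumℤ (λ j → x j ℤ.* y j)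

ℤ→ℚ-homo-· : ∀ {n} (x y : Fin n → ℤ) → ℤ→ℚ (x ·ℤ y) ≡ (ℤ→ℚ ∘ x) · (ℤ→ℚ ∘ y)
ℤ→ℚ-homo-· {zero} x y = refl
ℤ→ℚ-homo-· {suc n} x y = trans (ℤ→ℚ-homo-+ (x zero ℤ.* y zero) _)
  (cong₂ ℚ._+_ (ℤ→ℚ-homo-* (x zero) (y zero)) (ℤ→ℚ-homo-· (x ∘ suc) (y ∘ suc)))

·ℤ-distrib-+ : ∀ {n} (a x y : Fin n → ℤ) → a ·ℤ (λ j → x j ℤ.+ y j) ≡ a ·ℤ x ℤ.+ a ·ℤ y
·ℤ-distrib-+ {zero} a x y = refl
·ℤ-distrib-+ {suc n} a x y = trans (cong (ℤ._+_ (a zero ℤ.* (x zero ℤ.+ y zero))) (·ℤ-distrib-+ (a ∘ suc) (x ∘ suc) (y ∘ suc)))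
  (solve 5 (λ a x y s t → a :* (x :+ y) :+ (s :+ t) := (a :* x :+ s) :+ (a :* y :+ t)) refl (a zero) (x zero) (y zero) _ _)
  where open ℤ-Solver

·ℤ-distrib-- : ∀ {n} (a x y : Fin n → ℤ) → a ·ℤ (λ j → x j ℤ.- y j) ≡ a ·ℤ x ℤ.- a ·ℤ y
·ℤ-distrib-- {zero} a x y = refl
·ℤ-distrib-- {suc n} a x y = trans (cong (ℤ._+_ (a zero ℤ.* (x zero ℤ.- y zero))) (·ℤ-distrib-- (a ∘ suc) (x ∘ suc) (y ∘ suc)))
  (solve 5 (λ a x y s t → a :* (x :- y) :+ (s :- t) := (a :* x :+ s) :- (a :* y :+ t)) refl (a zero) (x zero) (y zero) _ _)
  where open ℤ-Solver

·-combination : ∀ {n k} (a : ℚ^ n) (c : Fin k → ℚ^ n) (λv : Fin k → ℚ) (u : ℚ^ n) →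
  a · u ≡ sumℚ (λ t → λv t ℚ.* (c t · u)) ℚ.+ (λ j → a j ℚ.- sumℚ (λ t → λv t ℚ.* c t j)) · u
·-combination {n} {k} a c λv u = begin
  a · u                      ≡⟨ solve 2 (λ x l → x := l :+ (x :- l)) refl (a · u) Λ ⟩
  Λ ℚ.+ (a · u ℚ.- Λ)        ≡⟨ cong (λ w → Λ ℚ.+ (a · u ℚ.- w)) combination-· ⟨
  Λ ℚ.+ (a · u ℚ.- S · u)    ≡⟨ cong (Λ ℚ.+_) residual-· ⟨
  Λ ℚ.+ (λ j → a j ℚ.- S j) · u ∎
  where
  open ≡-Reasoning
  open +-*-Solver
  S : ℚ^ n
  S j = sumℚ (λ t → λv t ℚ.* c t j)
  Λ : ℚ
  Λ = sumℚ (λ t → λv t ℚ.* (c t · u))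
  residual-· : (λ j → a j ℚ.- S j) · u ≡ a · u ℚ.- S · u
  residual-· = begin
    sumℚ (λ j → (a j ℚ.- S j) ℚ.* u j)                ≡⟨ sumℚ-cong (λ j →
      solve 3 (λ a s u → (a :- s) :* u := a :* u :+ (:- (s :* u))) refl (a j) (S j) (u j)) ⟩
    sumℚ (λ j → a j ℚ.* u j ℚ.+ ℚ.- (S j ℚ.* u j))   ≡⟨ sumℚ-distrib-+ (λ j → a j ℚ.* u j) (λ j → ℚ.- (S j ℚ.* u j)) ⟩
    a · u ℚ.+ sumℚ (λ j → ℚ.- (S j ℚ.* u j))          ≡⟨ cong (a · u ℚ.+_) (sumℚ-neg (λ j → S j ℚ.* u j)) ⟩
    a · u ℚ.- S · u                                    ∎
  combination-· : S · u ≡ Λ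
  combination-· = begin
    sumℚ (λ j → S j ℚ.* u j)                           ≡⟨ sumℚ-cong (λ j →
      trans (ℚP.*-comm (S j) (u j)) (*-distribˡ-sumℚ (u j) (λ t → λv t ℚ.* c t j))) ⟩
    sumℚ (λ j → sumℚ (λ t → u j ℚ.* (λv t ℚ.* c t j)))  ≡⟨ sumℚ-cong (λ j → sumℚ-cong (λ t →
      solve 3 (λ u l x → u :* (l :* x) := l :* (x :* u)) refl (u j) (λv t) (c t j))) ⟩
    sumℚ (λ j → sumℚ (λ t → λv t ℚ.* (c t j ℚ.* u j)))  ≡⟨ sumℚ-comm (λ j t → λv t ℚ.* (c t j ℚ.* u j)) ⟩
    sumℚ (λ t → sumℚ (λ j → λv t ℚ.* (c t j ℚ.* u j)))  ≡⟨ sumℚ-cong (λ t → *-distribˡ-sumℚ (λv t) (λ j → c t j ℚ.* u j)) ⟨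
    Λ                                                   ∎

bit : Bool → ℤ
bit true = + 1
bit false = 0ℤ

⊔0≡⊓0+∣∣ : ∀ r → r ⊔ 0ℚ ≡ r ⊓ 0ℚ ℚ.+ ∣ r ∣
⊔0≡⊓0+∣∣ r with ℚP.≤-total 0ℚ r
... | inj₁ 0≤r = trans (ℚP.p≥q⇒p⊔q≡p 0≤r)
  (sym (trans (cong₂ ℚ._+_ (ℚP.p≥q⇒p⊓q≡q 0≤r) (ℚP.0≤p⇒∣p∣≡p 0≤r)) (ℚP.+-identityˡ r)))
... | inj₂ r≤0 = trans (ℚP.p≤q⇒p⊔q≡q r≤0)
  (sym (trans (cong₂ ℚ._+_ (ℚP.p≤q⇒p⊓q≡p r≤0) ∣r∣≡-r) (ℚP.+-inverseʳ r)))
  where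
  ∣r∣≡-r : ∣ r ∣ ≡ ℚ.- r
  ∣r∣≡-r = trans (sym (ℚP.∣-p∣≡∣p∣ r)) (ℚP.0≤p⇒∣p∣≡p (ℚP.neg-antimono-≤ r≤0))

⊓0≤*bit : ∀ r b → r ⊓ 0ℚ ℚ.≤ r ℚ.* ℤ→ℚ (bit b)
⊓0≤*bit r true = subst (r ⊓ 0ℚ ℚ.≤_) (sym (ℚP.*-identityʳ r)) (ℚP.p⊓q≤p r 0ℚ)
⊓0≤*bit r false = subst (r ⊓ 0ℚ ℚ.≤_) (sym (ℚP.*-zeroʳ r)) (ℚP.p⊓q≤q r 0ℚ)

*bit≤⊔0 : ∀ r b → r ℚ.* ℤ→ℚ (bit b) ℚ.≤ r ⊔ 0ℚ
*bit≤⊔0 r true = subst (ℚ._≤ r ⊔ 0ℚ) (sym (ℚP.*-identityʳ r)) (ℚP.p≤p⊔q r 0ℚ)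
*bit≤⊔0 r false = subst (ℚ._≤ r ⊔ 0ℚ) (sym (ℚP.*-zeroʳ r)) (ℚP.p≤q⊔p r 0ℚ)

·-bits-bounds : ∀ {n} (r : ℚ^ n) (u : Fin n → Bool) →
  sumℚ (λ j → r j ⊓ 0ℚ) ℚ.≤ r · (ℤ→ℚ ∘ bit ∘ u) ×
  r · (ℤ→ℚ ∘ bit ∘ u) ℚ.≤ sumℚ (λ j → r j ⊓ 0ℚ) ℚ.+ norm1 r
·-bits-bounds r u =
  sumℚ-mono-≤ (λ j → ⊓0≤*bit (r j) (u j)) ,
  ℚP.≤-trans (sumℚ-mono-≤ (λ j → *bit≤⊔0 (r j) (u j)))
    (ℚP.≤-reflexive (trans (sumℚ-cong (⊔0≡⊓0+∣∣ ∘ r)) (sumℚ-distrib-+ (λ j → r j ⊓ 0ℚ) (λ j → ∣ r j ∣))))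

combineΠ : ∀ {m} {s : Fin m → ℕ} → ((i : Fin m) → Fin (s i)) → Fin (prodℕ s)
combineΠ {zero} c = zero
combineΠ {suc m} c = combine (c zero) (combineΠ (c ∘ suc))

combineΠ-injective : ∀ {m} {s : Fin m → ℕ} (c c′ : (i : Fin m) → Fin (s i)) →
  combineΠ c ≡ combineΠ c′ → ∀ i → c i ≡ c′ i
combineΠ-injective {suc m} c c′ eq zero = proj₁ (combine-injective (c zero) _ (c′ zero) _ eq)
combineΠ-injective {suc m} c c′ eq (suc i) =
  combineΠ-injective (c ∘ suc) (c′ ∘ suc) (proj₂ (combine-injective (c zero) _ (c′ zero) _ eq)) i

boundedℤ→Fin : ∀ {z} (d : ℕ) → 0ℤ ℤ.≤ z → z ℤ.≤ + d → Fin (suc d)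
boundedℤ→Fin {+ k} d _ (+≤+ k≤d) = fromℕ< (s≤s k≤d)

boundedℤ→Fin-injective : ∀ {z z′} d {p q p′ q′} → boundedℤ→Fin {z} d p q ≡ boundedℤ→Fin {z′} d p′ q′ → z ≡ z′
boundedℤ→Fin-injective {+ k} {+ k′} d {q = +≤+ k≤d} {q′ = +≤+ k′≤d} eq =
  cong +_ (trans (sym (toℕ-fromℕ< (s≤s k≤d))) (trans (cong toℕ eq) (toℕ-fromℕ< (s≤s k′≤d))))

module TriangularCode {m} {U : Set} (d : Fin m → ℕ) (g M : Fin m → U → ℤ)
  (M≤g : ∀ i u → M i u ℤ.≤ g i u) (g≤M+d : ∀ i u → g i u ℤ.≤ M i u ℤ.+ + d i)
  (M-causal : ∀ i {u u′} → (∀ {k} → k Fin.< i → g k u ≡ g k u′) → M i u ≡ M i u′) where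

  offset : U → (i : Fin m) → Fin (suc (d i))
  offset u i = boundedℤ→Fin (d i) (ℤP.i≤j⇒0≤j-i (M≤g i u)) g-M≤d
    where
    g-M≤d : g i u ℤ.- M i u ℤ.≤ + d i
    g-M≤d = subst (g i u ℤ.- M i u ℤ.≤_) (solve 2 (λ a b → a :+ b :- a := b) refl (M i u) (+ d i))
      (ℤP.+-monoˡ-≤ (ℤ.- M i u) (g≤M+d i u))
      where open ℤ-Solver

  code : U → Fin (prodℕ (λ i → suc (d i)))
  code u = combineΠ (offset u)

  code-injective-on-g : ∀ {u u′} → code u ≡ code u′ → ∀ i → g i u ≡ g i u′
  code-injective-on-g {u} {u′} eq = WF.All.wfRec FinInd.<-wellFounded 0ℓ (λ i → g i u ≡ g i u′) step
    where
    open ℤ-Solver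
    split : ∀ a b → a ≡ (a ℤ.- b) ℤ.+ b
    split = solve 2 (λ a b → a := (a :- b) :+ b) refl
    step : ∀ i → WfRec Fin._<_ (λ k → g k u ≡ g k u′) i → g i u ≡ g i u′
    step i earlier = begin
      g i u                            ≡⟨ split (g i u) (M i u) ⟩
      (g i u ℤ.- M i u) ℤ.+ M i u      ≡⟨ cong₂ ℤ._+_ offsets-agree (M-causal i earlier) ⟩
      (g i u′ ℤ.- M i u′) ℤ.+ M i u′   ≡⟨ split (g i u′) (M i u′) ⟨
      g i u′                           ∎
      where
      open ≡-Reasoning
      offsets-agree : g i u ℤ.- M i u ≡ g i u′ ℤ.- M i u′
      offsets-agree = boundedℤ→Fin-injective (d i) (combineΠ-injective (offset u) (offset u′) eq i)

open Injection (↔⇒↣ 2↔Bool) using () renaming (to to toBool; injective to toBool-injective)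

subsetsOfSupport : ∀ {n} (v : ℚ^ n) → Fin (2 ^ suppSize v) → Fin n → Bool
subsetsOfSupport {zero} v c ()
subsetsOfSupport {suc n} v c with v zero ≟ 0ℚ
... | yes _ = false ∷ subsetsOfSupport (tail v) c
... | no _ = let (b , c′) = remQuot (2 ^ suppSize (tail v)) c in toBool b ∷ subsetsOfSupport (tail v) c′

subsetsOfSupport-⊆ : ∀ {n} (v : ℚ^ n) c j → subsetsOfSupport v c j ≡ true → v j ≢ 0ℚ
subsetsOfSupport-⊆ {suc n} v c j with v zero ≟ 0ℚ
subsetsOfSupport-⊆ v c (suc j) | yes _ = subsetsOfSupport-⊆ (tail v) c j
subsetsOfSupport-⊆ v c zero | no v₀≢0 = λ _ → v₀≢0
subsetsOfSupport-⊆ v c (suc j) | no _ = subsetsOfSupport-⊆ (tail v) _ j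

subsetsOfSupport-injective : ∀ {n} (v : ℚ^ n) {c c′} →
  (∀ j → subsetsOfSupport v c j ≡ subsetsOfSupport v c′ j) → c ≡ c′
subsetsOfSupport-injective {zero} v {zero} {zero} _ = refl
subsetsOfSupport-injective {suc n} v {c} {c′} eq with v zero ≟ 0ℚ
... | yes _ = subsetsOfSupport-injective (tail v) (eq ∘ suc)
... | no _ = Injection.injective (↔⇒↣ (*↔× {2} {2 ^ suppSize (tail v)}))
  (cong₂ _,_ (toBool-injective (eq zero)) (subsetsOfSupport-injective (tail v) (eq ∘ suc)))

IntegerPoint : ∀ {m n} → Mat m n → (Fin m → ℤ) → ℚ^ n → Set
IntegerPoint A b y = Σ _ λ x → InP∩ℤ A b x × (∀ j → y j ≡ ℤ→ℚ (x j))

Conv-point : ∀ {n} (S : ℚ^ n → Set) {y} → S y → Conv S y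
Conv-point S {y} y∈S = 1 , (λ _ → y) , (λ _ → 1ℚ) , (λ _ → ℚP.nonNegative⁻¹ 1ℚ) , refl , (λ _ → y∈S) ,
  (λ j → sym (trans (ℚP.+-identityʳ _) (ℚP.*-identityˡ _)))

vertex-integral : ∀ {m n} (A : Mat m n) b {v} → IsVertex A b v →
  Σ (Fin n → ℤ) λ x → InP∩ℤ A b x × (∀ j → v j ≡ ℤ→ℚ (x j))
vertex-integral A b {v} ((k , p , w , w≥0 , Σw≡1 , p∈P , v≡Σwp) , v∉Conv)
  with any? (λ t → all? (λ j → p t j ≟ v j))
... | yes (t , pₜ≡v) = let (x , x∈P , pₜ≡x) = p∈P t in x , x∈P , λ j → trans (sym (pₜ≡v j)) (pₜ≡x j)
... | no p≢v = ⊥-elim (v∉Conv (k , p , w , w≥0 , Σw≡1 , p∈PI∖v , v≡Σwp))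
  where
  p∈PI∖v : ∀ t → InPI A b (p t) × ¬ (∀ j → p t j ≡ v j)
  p∈PI∖v t = Conv-point (IntegerPoint A b) (p∈P t) , λ pₜ≡v → p≢v (t , pₜ≡v)

midpoint-of-vertex⇒≡ : ∀ {m n} (A : Mat m n) b {v : ℚ^ n} {x y z : Fin n → ℤ} →
  IsVertex A b v → (∀ j → v j ≡ ℤ→ℚ (x j)) →
  InP∩ℤ A b y → InP∩ℤ A b z → (∀ j → y j ℤ.+ z j ≡ x j ℤ.+ x j) → ∀ j → y j ≡ x j
midpoint-of-vertex⇒≡ A b {v} {x} {y} {z} (_ , v∉Conv) v≡x y∈P z∈P y+z≡x+x with all? (λ j → y j ℤ.≟ x j)
... | yes y≡x = y≡x
... | no y≢x = ⊥-elim (v∉Conv (2 , Y ∷ Z ∷ [] , ½ ∷ ½ ∷ [] , ½≥0 , refl , ends , v≡midpoint))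
  where
  Y Z : ℚ^ _
  Y = ℤ→ℚ ∘ y
  Z = ℤ→ℚ ∘ z
  ½≥0 : ∀ t → 0ℚ ℚ.≤ (½ ∷ ½ ∷ []) t
  ½≥0 zero = ℚP.nonNegative⁻¹ ½
  ½≥0 (suc zero) = ℚP.nonNegative⁻¹ ½
  Y≢v : ¬ (∀ j → Y j ≡ v j)
  Y≢v Y≡v = y≢x (λ j → ℤ→ℚ-injective (trans (Y≡v j) (v≡x j)))
  Z≢v : ¬ (∀ j → Z j ≡ v j)
  Z≢v Z≡v = y≢x (λ j → ∙-cancelʳ (z j) (y j) (x j)
    (trans (y+z≡x+x j) (cong (ℤ._+_ (x j)) (sym (ℤ→ℚ-injective (trans (Z≡v j) (v≡x j)))))))
  ends : ∀ t → InPI A b ((Y ∷ Z ∷ []) t) × ¬ (∀ j → (Y ∷ Z ∷ []) t j ≡ v j)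
  ends zero = Conv-point (IntegerPoint A b) (y , y∈P , λ _ → refl) , Y≢v
  ends (suc zero) = Conv-point (IntegerPoint A b) (z , z∈P , λ _ → refl) , Z≢v
  v≡midpoint : ∀ j → v j ≡ ½ ℚ.* Y j ℚ.+ (½ ℚ.* Z j ℚ.+ 0ℚ)
  v≡midpoint j = trans (v≡x j) (trans (ℤ→ℚ-midpoint {x j} {y j} {z j} (y+z≡x+x j))
    (cong (½ ℚ.* Y j ℚ.+_) (sym (ℚP.+-identityʳ (½ ℚ.* Z j)))))

0≤x+bit-bit : ∀ {x} p q → 0ℤ ℤ.≤ x → (q ≡ true → x ≢ 0ℤ) → 0ℤ ℤ.≤ x ℤ.+ (bit p ℤ.- bit q)
0≤x+bit-bit {x} true true x≥0 _ = subst (0ℤ ℤ.≤_) (sym (ℤP.+-identityʳ x)) x≥0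
0≤x+bit-bit {x} false false x≥0 _ = subst (0ℤ ℤ.≤_) (sym (ℤP.+-identityʳ x)) x≥0
0≤x+bit-bit {x} true false x≥0 _ = ℤP.≤-trans x≥0 (ℤP.i≤i+j x (+ 1))
0≤x+bit-bit {+ zero} false true _ x≢0 = ⊥-elim (x≢0 refl refl)
0≤x+bit-bit {+ suc k} false true _ _ = +≤+ z≤n

x+bit-bit≡x⇒≡ : ∀ {x} p q → x ℤ.+ (bit p ℤ.- bit q) ≡ x → p ≡ q
x+bit-bit≡x⇒≡ {x} p q eq = bits-equal p q (∙-cancelˡ x (bit p ℤ.- bit q) 0ℤ (trans eq (sym (ℤP.+-identityʳ x))))
  where
  bits-equal : ∀ p q → bit p ℤ.- bit q ≡ 0ℤ → p ≡ q
  bits-equal true true _ = refl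
  bits-equal false false _ = refl

exchange-InP∩ℤ : ∀ {m n} (A : Mat m n) b {x} (u u′ : Fin n → Bool) → InP∩ℤ A b x →
  (∀ j → u′ j ≡ true → x j ≢ 0ℤ) → (∀ i → A i ·ℤ (bit ∘ u) ≡ A i ·ℤ (bit ∘ u′)) →
  InP∩ℤ A b (λ j → x j ℤ.+ (bit (u j) ℤ.- bit (u′ j)))
exchange-InP∩ℤ A b {x} u u′ (x≥0 , Ax≡b) u′⊆supp Au≡Au′ =
  (λ j → 0≤x+bit-bit (u j) (u′ j) (x≥0 j) (u′⊆supp j)) , λ i → begin
    A i ·ℤ (λ j → x j ℤ.+ (bit (u j) ℤ.- bit (u′ j)))             ≡⟨ ·ℤ-distrib-+ (A i) x _ ⟩
    A i ·ℤ x ℤ.+ A i ·ℤ (λ j → bit (u j) ℤ.- bit (u′ j))          ≡⟨ cong₂ ℤ._+_ (Ax≡b i) (·ℤ-distrib-- (A i) (bit ∘ u) (bit ∘ u′)) ⟩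
    b i ℤ.+ (A i ·ℤ (bit ∘ u) ℤ.- A i ·ℤ (bit ∘ u′))               ≡⟨ cong (ℤ._+_ (b i)) (ℤP.i≡j⇒i-j≡0 (Au≡Au′ i)) ⟩
    b i ℤ.+ 0ℤ                                                    ≡⟨ ℤP.+-identityʳ (b i) ⟩
    b i                                                           ∎
  where open ≡-Reasoning

vertex-separates-subsets : ∀ {m n} (A : Mat m n) b {v x} {u u′ : Fin n → Bool} →
  IsVertex A b v → (∀ j → v j ≡ ℤ→ℚ (x j)) → InP∩ℤ A b x →
  (∀ j → u j ≡ true → x j ≢ 0ℤ) → (∀ j → u′ j ≡ true → x j ≢ 0ℤ) →
  (∀ i → A i ·ℤ (bit ∘ u) ≡ A i ·ℤ (bit ∘ u′)) → ∀ j → u j ≡ u′ j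
vertex-separates-subsets A b {x = x} {u} {u′} vertex v≡x x∈P u⊆supp u′⊆supp Au≡Au′ j =
  x+bit-bit≡x⇒≡ {x j} (u j) (u′ j) (midpoint-of-vertex⇒≡ A b {x = x} vertex v≡x
    (exchange-InP∩ℤ A b u u′ x∈P u′⊆supp Au≡Au′)
    (exchange-InP∩ℤ A b u′ u x∈P u⊆supp (sym ∘ Au≡Au′))
    (λ j → solve 3 (λ x p q → (x :+ (p :- q)) :+ (x :+ (q :- p)) := x :+ x) refl (x j) (bit (u j)) (bit (u′ j)))
    j)
  where open ℤ-Solver

lowerFin< : ∀ {m} (i : Fin m) k → lowerFin i k Fin.< i
lowerFin< (suc i) zero = s≤s z≤n
lowerFin< (suc i) (suc k) = s≤s (lowerFin< i k)

module PrefixRounding {m n} (A : Mat m n) (π : Permutation m m) (d : Fin m → ℕ)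
  (ceilMin : ∀ i → IsCeilMin A π i (d i)) where

  g : Fin m → (Fin n → Bool) → ℤ
  g i u = A (π ⟨$⟩ʳ i) ·ℤ (bit ∘ u)

  λ* : (i : Fin m) → Fin (toℕ i) → ℚ
  λ* i = proj₁ (proj₁ (ceilMin i))

  ρ : Fin m → ℚ^ n
  ρ i = residual A π i (λ* i)

  predicted : Fin m → (Fin n → Bool) → ℚ
  predicted i u = sumℚ (λ k → λ* i k ℚ.* ℤ→ℚ (g (lowerFin i k) u))

  negatives : Fin m → ℚ
  negatives i = sumℚ (λ j → ρ i j ⊓ 0ℚ)

  estimate : Fin m → (Fin n → Bool) → ℚ
  estimate i u = predicted i u ℚ.+ negatives i

  g≡predicted+ρ· : ∀ i u → ℤ→ℚ (g i u) ≡ predicted i u ℚ.+ ρ i · (ℤ→ℚ ∘ bit ∘ u)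
  g≡predicted+ρ· i u = begin
    ℤ→ℚ (g i u)                                              ≡⟨ ℤ→ℚ-homo-· (A (π ⟨$⟩ʳ i)) (bit ∘ u) ⟩
    row i · ū                                                ≡⟨ ·-combination (row i) (row ∘ lowerFin i) (λ* i) ū ⟩
    sumℚ (λ k → λ* i k ℚ.* (row (lowerFin i k) · ū)) ℚ.+ ρ i · ū ≡⟨ cong (ℚ._+ ρ i · ū) (sumℚ-cong (λ k →
      cong (λ* i k ℚ.*_) (ℤ→ℚ-homo-· (A (π ⟨$⟩ʳ lowerFin i k)) (bit ∘ u)))) ⟨
    predicted i u ℚ.+ ρ i · ū                                ∎
    where
    open ≡-Reasoning
    row : Fin m → ℚ^ n
    row k = ℤ→ℚ ∘ A (π ⟨$⟩ʳ k)
    ū : ℚ^ n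
    ū = ℤ→ℚ ∘ bit ∘ u

  estimate-window : ∀ i u → estimate i u ℚ.≤ ℤ→ℚ (g i u) × ℤ→ℚ (g i u) ℚ.≤ estimate i u ℚ.+ ℕ→ℚ (d i)
  estimate-window i u = (begin
      estimate i u                          ≤⟨ ℚP.+-monoʳ-≤ (predicted i u) lower ⟩
      predicted i u ℚ.+ ρ i · ū             ≡⟨ g≡predicted+ρ· i u ⟨
      ℤ→ℚ (g i u)                           ∎) , (begin
      ℤ→ℚ (g i u)                           ≡⟨ g≡predicted+ρ· i u ⟩
      predicted i u ℚ.+ ρ i · ū             ≤⟨ ℚP.+-monoʳ-≤ (predicted i u) (ℚP.≤-trans upper (ℚP.+-monoʳ-≤ (negatives i) ‖ρ‖≤d)) ⟩
      predicted i u ℚ.+ (negatives i ℚ.+ ℕ→ℚ (d i)) ≡⟨ ℚP.+-assoc (predicted i u) (negatives i) (ℕ→ℚ (d i)) ⟨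
      estimate i u ℚ.+ ℕ→ℚ (d i)            ∎)
    where
    open ℚP.≤-Reasoning
    ū : ℚ^ n
    ū = ℤ→ℚ ∘ bit ∘ u
    lower : negatives i ℚ.≤ ρ i · ū
    lower = proj₁ (·-bits-bounds (ρ i) u)
    upper : ρ i · ū ℚ.≤ negatives i ℚ.+ norm1 (ρ i)
    upper = proj₂ (·-bits-bounds (ρ i) u)
    ‖ρ‖≤d : norm1 (ρ i) ℚ.≤ ℕ→ℚ (d i)
    ‖ρ‖≤d = proj₂ (proj₁ (ceilMin i))

  M : Fin m → (Fin n → Bool) → ℤ
  M i u = ⌊ estimate i u ⌋

  M-window : ∀ i u → M i u ℤ.≤ g i u × g i u ℤ.≤ M i u ℤ.+ + d i
  M-window i u = floor-window (d i) (proj₁ (estimate-window i u)) (proj₂ (estimate-window i u))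

  M-causal : ∀ i {u u′} → (∀ {k} → k Fin.< i → g k u ≡ g k u′) → M i u ≡ M i u′
  M-causal i earlier = cong (λ s → ⌊ s ℚ.+ negatives i ⌋)
    (sumℚ-cong (λ k → cong (λ z → λ* i k ℚ.* ℤ→ℚ z) (earlier (lowerFin< i k))))

  open TriangularCode d g M (λ i u → proj₁ (M-window i u)) (λ i u → proj₂ (M-window i u)) M-causal public
    using (code; code-injective-on-g)

  code-injective-on-rows : ∀ {u u′} → code u ≡ code u′ → ∀ r → A r ·ℤ (bit ∘ u) ≡ A r ·ℤ (bit ∘ u′)
  code-injective-on-rows {u} {u′} eq r =
    subst (λ r′ → A r′ ·ℤ (bit ∘ u) ≡ A r′ ·ℤ (bit ∘ u′)) (inverseʳ π) (code-injective-on-g {u} {u′} eq (π ⟨$⟩ˡ r))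

lemma22 : (m n : ℕ) (A : Mat m n) (b : Fin m → ℤ) (v : ℚ^ n) →
    IsVertex A b v →
    (π : Permutation m m) (d : Fin m → ℕ) → (∀ i → IsCeilMin A π i (d i)) →
    2 ^ suppSize v ≤ prodℕ (λ i → suc (d i))
lemma22 m n A b v vertex π d ceilMin with vertex-integral A b vertex
... | x , x∈P , v≡x = injective⇒≤ {f = code ∘ subsetsOfSupport v} λ {c} {c′} eq →
  -- u and u′ are passed explicitly: inferring them from code u ≡ code u′
  -- makes Agda unfold ⌊_⌋ on symbolic rationals.
  subsetsOfSupport-injective v (vertex-separates-subsets A b vertex v≡x x∈P (⊆supp c) (⊆supp c′)
    (code-injective-on-rows {subsetsOfSupport v c} {subsetsOfSupport v c′} eq))
  where
  open PrefixRounding A π d ceilMin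
  ⊆supp : ∀ c j → subsetsOfSupport v c j ≡ true → x j ≢ 0ℤ
  ⊆supp c j e x≡0 = subsetsOfSupport-⊆ v c j e (trans (v≡x j) (cong ℤ→ℚ x≡0))
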